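{- For every integer $n\geq 1$ there is an orientation of the path on $n$ vertices (i.e. a dipath $P_n$) that admits a strong SAML with magic constant $\mu=n$.
   Context: All digraphs are finite and simple. A dipath $P_n$ is the path graph on $n$ vertices with each edge given a direction; the orientation need not be consistent along the path. For a digraph $G=(V,A)$, a total labeling is a bijection $\lambda:V\cup A\to\{1,2,\ldots,|V|+|A|\}$. For an arc $xy\in A$ (tail $x$, head $y$) its subtractive arc-weight is $wt^-(xy)=\lambda(xy)+\lambda(y)-\lambda(x)$. A total labeling is an SAML (subtractive arc-magic labeling) if $wt^-(xy)$ equals the same integer $\mu$ (the magic constant) for every arc $xy\in A$. A total labeling is strong if $\lambda(V)=\{1,2,\ldots,|V|\}$. -}

module Defs where

open import Data.Nat using (ℕ; suc; _+_; _∸_; _≤_)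
open import Data.Fin using (Fin; toℕ; inject₁) renaming (suc to fsuc)
open import Data.Bool using (Bool; true; false)
open import Data.Sum using (_⊎_; inj₁; inj₂)
open import Data.Product using (Σ; _×_; _,_)
open import Function.Bundles using (_⤖_; Bijection)
open import Relation.Binary.PropositionalEquality using (_≡_)

record Digraph (n m : ℕ) : Set where
  field
    tail : Fin m → Fin n
    head : Fin m → Fin n

-- An orientation of the path v₀ v₁ … v_k (k edges) is one Bool per edge
-- {v_i , v_{i+1}}: true = arc v_i → v_{i+1}, false = arc v_{i+1} → v_i.
dipath : (k : ℕ) → (Fin k → Bool) → Digraph (suc k) k
dipath k o = record { tail = t ; head = h }
  where
    t : Fin k → Fin (suc k)
    t i with o i
    ... | true  = inject₁ i
    ... | false = fsuc i
    h : Fin k → Fin (suc k)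
    h i with o i
    ... | true  = fsuc i
    ... | false = inject₁ i

Elem : (n m : ℕ) → Set
Elem n m = Fin n ⊎ Fin m

-- A total labeling: bijection V ∪ A → {1,…,|V|+|A|}; we encode the label
-- set {1,…,N} as Fin N, with label value toℕ + 1.
TotalLabeling : (n m : ℕ) → Set
TotalLabeling n m = Elem n m ⤖ Fin (n + m)

lab : ∀ {n m} → TotalLabeling n m → Elem n m → ℕ
lab L x = suc (toℕ (Bijection.to L x))

-- wt⁻(xy) = λ(xy) + λ(y) − λ(x) equals μ, written without subtraction as
-- λ(xy) + λ(y) = μ + λ(x).
IsSAML : ∀ {n m} → Digraph n m → TotalLabeling n m → ℕ → Set
IsSAML {n} {m} G L μ =
  (a : Fin m) →
    lab L (inj₂ a) + lab L (inj₁ (Digraph.head G a)) ≡ μ + lab L (inj₁ (Digraph.tail G a))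

-- Strong: λ(V) = {1,…,|V|}, i.e. every vertex gets a label ≤ n
-- (by bijectivity this is equivalent to λ(V) = {1,…,n}).
IsStrong : ∀ {n m} → TotalLabeling n m → Set
IsStrong {n} {m} L = (v : Fin n) → lab L (inj₁ v) ≤ n

-- Label the vertices v₀ v₁ … v_k of the path by the zigzag 1, k+1, 2, k, 3, …,
-- so that the two ends of the i-th edge {vᵢ, vᵢ₊₁} differ by k − i. Orient each
-- edge from its larger to its smaller end and give it the label (k+1) + (k−i):
-- its subtractive weight is then (k+1) + (k−i) − (k−i) = k+1, and the edge
-- labels k+2, …, 2k+1 are exactly those not used on the vertices.
module Submission where

open import Defs
open import Data.Nat using (ℕ; zero; suc; _+_; _∸_; _≤_; _<_; s≤s; s≤s⁻¹; ⌊_/2⌋)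
open import Data.Nat.Properties
open import Data.Nat.Tactic.RingSolver using (solve-∀)
open import Data.Bool using (Bool; true; false; if_then_else_)
open import Data.Fin using (Fin; toℕ; fromℕ<; punchOut; splitAt; join)
import Data.Fin.Properties as Fin
open import Data.Sum using (_⊎_; inj₁; inj₂)
open import Data.Product using (Σ; _×_; _,_; map)
open import Data.Empty using (⊥-elim)
open import Relation.Nullary using (yes; no; contradiction)
open import Relation.Binary.PropositionalEquality
open import Function.Base using (_∘_; id)
open import Function.Bundles using (_⤖_; mk⤖)
open import Function.Definitions using (Injective; StrictlySurjective)
open import Function.Consequences.Propositional using (strictlySurjective⇒surjective)

injective⇒strictlySurjective : ∀ {n} {f : Fin n → Fin n} →
  Injective _≡_ _≡_ f → StrictlySurjective _≡_ f
injective⇒strictlySurjective {suc n} {f} f-inj y with Fin.any? (λ x → f x Fin.≟ y)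
... | yes hit = hit
... | no ¬hit = contradiction (Fin.injective⇒≤ g-inj) (<-irrefl refl)
  where
    missed : ∀ x → y ≢ f x
    missed x y≡fx = ¬hit (x , sym y≡fx)

    g : Fin (suc n) → Fin n
    g x = punchOut (missed x)

    g-inj : Injective _≡_ _≡_ g
    g-inj eq = f-inj (Fin.punchOut-injective (missed _) (missed _) eq)

injection⇒bijection : ∀ {n m} (f : Fin n ⊎ Fin m → Fin (n + m)) →
  Injective _≡_ _≡_ f → (Fin n ⊎ Fin m) ⤖ Fin (n + m)
injection⇒bijection {n} {m} f f-inj =
  mk⤖ (f-inj , strictlySurjective⇒surjective f-surj)
  where
    splitAt-injective : Injective _≡_ _≡_ (splitAt n {m})
    splitAt-injective {i} {j} eq = begin
      i                       ≡⟨ Fin.join-splitAt n m i ⟨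
      join n m (splitAt n i)  ≡⟨ cong (join n m) eq ⟩
      join n m (splitAt n j)  ≡⟨ Fin.join-splitAt n m j ⟩
      j                       ∎
      where open ≡-Reasoning

    f-surj : StrictlySurjective _≡_ f
    f-surj y = map (splitAt n) id (injective⇒strictlySurjective
      {f = f ∘ splitAt n} (λ eq → splitAt-injective (f-inj eq)) y)

labeling : ∀ {n m} (val : Elem n m → ℕ) → (∀ x → val x < n + m) →
  (∀ {x y} → val x ≡ val y → x ≡ y) → TotalLabeling n m
labeling val val< val-inj =
  injection⇒bijection (λ x → fromℕ< (val< x))
    (λ eq → val-inj (Fin.fromℕ<-injective _ _ (val< _) (val< _) eq))

lab-labeling : ∀ {n m} (val : Elem n m → ℕ) (val< : ∀ x → val x < n + m)
  (val-inj : ∀ {x y} → val x ≡ val y → x ≡ y) →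
  ∀ x → lab (labeling val val< val-inj) x ≡ suc (val x)
lab-labeling val val< val-inj x = cong suc (Fin.toℕ-fromℕ< (val< x))

toℕ-tail : ∀ k (o : Fin k → Bool) a →
  toℕ (Digraph.tail (dipath k o) a) ≡ (if o a then toℕ a else suc (toℕ a))
toℕ-tail k o a with o a
... | true  = Fin.toℕ-inject₁ a
... | false = refl

toℕ-head : ∀ k (o : Fin k → Bool) a →
  toℕ (Digraph.head (dipath k o) a) ≡ (if o a then suc (toℕ a) else toℕ a)
toℕ-head k o a with o a
... | true  = refl
... | false = Fin.toℕ-inject₁ a

isOdd : ℕ → Bool
isOdd zero          = false
isOdd (suc zero)    = true
isOdd (suc (suc n)) = isOdd n

isOdd-double : ∀ j → isOdd (j + j) ≡ false
isOdd-double zero    = refl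
isOdd-double (suc j) rewrite +-suc j j = isOdd-double j

isOdd-suc-double : ∀ j → isOdd (suc (j + j)) ≡ true
isOdd-suc-double zero    = refl
isOdd-suc-double (suc j) rewrite +-suc j j = isOdd-suc-double j

⌊suc[n+n]/2⌋≡n : ∀ n → ⌊ suc (n + n) /2⌋ ≡ n
⌊suc[n+n]/2⌋≡n zero    = refl
⌊suc[n+n]/2⌋≡n (suc n) rewrite +-suc n n = cong suc (⌊suc[n+n]/2⌋≡n n)

data EvenOdd : ℕ → Set where
  even : ∀ j → EvenOdd (j + j)
  odd  : ∀ j → EvenOdd (suc (j + j))

evenOdd : ∀ n → EvenOdd n
evenOdd zero = even zero
evenOdd (suc n) with evenOdd n
... | even j = odd j
... | odd j  = subst EvenOdd (cong suc (+-suc j j)) (even (suc j))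

∸-split : ∀ a b {k} → a + b ≤ k → k ∸ a ≡ b + (k ∸ (a + b))
∸-split a b {k} a+b≤k = begin
  k ∸ a               ≡⟨ cong (_∸ a) (m+[n∸m]≡n a+b≤k) ⟨
  a + b + e ∸ a       ≡⟨ cong (_∸ a) (+-assoc a b e) ⟩
  a + (b + e) ∸ a     ≡⟨ m+n∸m≡n a (b + e) ⟩
  b + e               ∎
  where
    open ≡-Reasoning
    e : ℕ
    e = k ∸ (a + b)

m+m<n⇒n<[n∸m]+[n∸m] : ∀ m {n} → m + m < n → n < (n ∸ m) + (n ∸ m)
m+m<n⇒n<[n∸m]+[n∸m] m {n} m+m<n = begin-strict
  n          ≡⟨ m+[n∸m]≡n m≤n ⟨
  m + e      <⟨ +-monoˡ-< e m<e ⟩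
  e + e      ∎
  where
    open ≤-Reasoning
    e : ℕ
    e = n ∸ m
    m≤n : m ≤ n
    m≤n = ≤-trans (m≤m+n m m) (<⇒≤ m+m<n)
    m<e : m < e
    m<e = +-cancelˡ-< m m e (subst (m + m <_) (sym (m+[n∸m]≡n m≤n)) m+m<n)

zigzag : ℕ → ℕ → ℕ
zigzag k i = if isOdd i then k ∸ ⌊ i /2⌋ else ⌊ i /2⌋

higherEnd lowerEnd : ℕ → ℕ
higherEnd i = if isOdd i then i else suc i
lowerEnd  i = if isOdd i then suc i else i

zigzag-double : ∀ k j → zigzag k (j + j) ≡ j
zigzag-double k j rewrite isOdd-double j = sym (n≡⌊n+n/2⌋ j)

zigzag-suc-double : ∀ k j → zigzag k (suc (j + j)) ≡ k ∸ j
zigzag-suc-double k j rewrite isOdd-suc-double j | ⌊suc[n+n]/2⌋≡n j = refl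

zigzag-≤ : ∀ k i → i ≤ k → zigzag k i ≤ k
zigzag-≤ k i i≤k with evenOdd i
... | even j rewrite zigzag-double k j     = ≤-trans (m≤m+n j j) i≤k
... | odd j  rewrite zigzag-suc-double k j = m∸n≤m k j

-- Even positions carry values in the lower half of [0, k], odd ones in the upper half.
zigzag-even≢odd : ∀ k j j′ → j + j ≤ k → j′ + j′ < k →
  zigzag k (j + j) ≢ zigzag k (suc (j′ + j′))
zigzag-even≢odd k j j′ j+j≤k j′+j′<k eq
  rewrite zigzag-double k j | zigzag-suc-double k j′ | eq =
  <⇒≱ (m+m<n⇒n<[n∸m]+[n∸m] j′ j′+j′<k) j+j≤k

zigzag-injective : ∀ k i i′ → i ≤ k → i′ ≤ k → zigzag k i ≡ zigzag k i′ → i ≡ i′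
zigzag-injective k i i′ i≤k i′≤k eq with evenOdd i | evenOdd i′
... | even j | even j′ rewrite zigzag-double k j | zigzag-double k j′ =
  cong (λ t → t + t) eq
... | odd j  | odd j′ rewrite zigzag-suc-double k j | zigzag-suc-double k j′ =
  cong (λ t → suc (t + t)) (∸-cancelˡ-≡ (half≤ j i≤k) (half≤ j′ i′≤k) eq)
  where
    half≤ : ∀ j → j + j < k → j ≤ k
    half≤ j le = ≤-trans (m≤m+n j j) (<⇒≤ le)
... | even j | odd j′ = ⊥-elim (zigzag-even≢odd k j j′ i≤k i′≤k eq)
... | odd j  | even j′ = ⊥-elim (zigzag-even≢odd k j′ j i′≤k i≤k (sym eq))

zigzag-gap : ∀ k i → i < k → zigzag k (higherEnd i) ≡ zigzag k (lowerEnd i) + (k ∸ i)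
zigzag-gap k i i<k with evenOdd i
... | even j rewrite isOdd-double j | zigzag-suc-double k j | zigzag-double k j =
  ∸-split j j (<⇒≤ i<k)
... | odd j rewrite isOdd-suc-double j | zigzag-suc-double k j = begin
  k ∸ j
    ≡⟨ ∸-split j (suc j) j+suc-j≤k ⟩
  suc j + (k ∸ (j + suc j))
    ≡⟨ cong₂ _+_ (zigzag-double k (suc j)) (cong (k ∸_) (sym (+-suc j j))) ⟨
  zigzag k (suc j + suc j) + (k ∸ suc (j + j))
    ≡⟨ cong (λ t → zigzag k (suc t) + (k ∸ suc (j + j))) (+-suc j j) ⟩
  zigzag k (suc (suc (j + j))) + (k ∸ suc (j + j)) ∎
  where
    open ≡-Reasoning
    j+suc-j≤k : j + suc j ≤ k
    j+suc-j≤k = subst (_≤ k) (sym (+-suc j j)) (<⇒≤ i<k)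

orientation : (k : ℕ) → Fin k → Bool
orientation k a = isOdd (toℕ a)

module _ (k : ℕ) where

  value : Elem (suc k) k → ℕ
  value (inj₁ v) = zigzag k (toℕ v)
  value (inj₂ a) = k + (k ∸ toℕ a)

  vertexValue≤k : ∀ v → zigzag k (toℕ v) ≤ k
  vertexValue≤k v = zigzag-≤ k (toℕ v) (s≤s⁻¹ (Fin.toℕ<n v))

  k<arcValue : ∀ a → k < k + (k ∸ toℕ a)
  k<arcValue a = m<m+n k (m<n⇒0<n∸m (Fin.toℕ<n a))

  value< : ∀ x → value x < suc k + k
  value< (inj₁ v) = s≤s (≤-trans (vertexValue≤k v) (m≤m+n k k))
  value< (inj₂ a) = s≤s (+-monoʳ-≤ k (m∸n≤m k (toℕ a)))

  value-injective : ∀ {x y} → value x ≡ value y → x ≡ y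
  value-injective {inj₁ v} {inj₁ w} eq = cong inj₁ (Fin.toℕ-injective
    (zigzag-injective k (toℕ v) (toℕ w) (s≤s⁻¹ (Fin.toℕ<n v)) (s≤s⁻¹ (Fin.toℕ<n w)) eq))
  value-injective {inj₁ v} {inj₂ a} eq =
    ⊥-elim (<⇒≱ (k<arcValue a) (subst (_≤ k) eq (vertexValue≤k v)))
  value-injective {inj₂ a} {inj₁ v} eq =
    ⊥-elim (<⇒≱ (k<arcValue a) (subst (_≤ k) (sym eq) (vertexValue≤k v)))
  value-injective {inj₂ a} {inj₂ b} eq = cong inj₂ (Fin.toℕ-injective
    (∸-cancelˡ-≡ (<⇒≤ (Fin.toℕ<n a)) (<⇒≤ (Fin.toℕ<n b)) (+-cancelˡ-≡ k _ _ eq)))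

  zigzagLabeling : TotalLabeling (suc k) k
  zigzagLabeling = labeling value value< value-injective

  lab-zigzagLabeling : ∀ x → lab zigzagLabeling x ≡ suc (value x)
  lab-zigzagLabeling = lab-labeling value value< value-injective

  zigzagLabeling-strong : IsStrong zigzagLabeling
  zigzagLabeling-strong v =
    subst (_≤ suc k) (sym (lab-zigzagLabeling (inj₁ v))) (s≤s (vertexValue≤k v))

  zigzagLabeling-saml : IsSAML (dipath k (orientation k)) zigzagLabeling (suc k)
  zigzagLabeling-saml a = begin
    lab L (inj₂ a) + lab L (inj₁ (head a))
      ≡⟨ cong₂ _+_ (lab-zigzagLabeling (inj₂ a)) (vertexLab (head a)) ⟩
    suc (k + d) + suc (zigzag k (toℕ (head a)))
      ≡⟨ cong (λ t → suc (k + d) + suc (zigzag k t)) (toℕ-head k (orientation k) a) ⟩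
    suc (k + d) + suc (zigzag k (lowerEnd i))
      ≡⟨ weight k d (zigzag k (lowerEnd i)) ⟩
    suc k + suc (zigzag k (lowerEnd i) + d)
      ≡⟨ cong (λ t → suc k + suc t) (zigzag-gap k i (Fin.toℕ<n a)) ⟨
    suc k + suc (zigzag k (higherEnd i))
      ≡⟨ cong (λ t → suc k + suc (zigzag k t)) (toℕ-tail k (orientation k) a) ⟨
    suc k + suc (zigzag k (toℕ (tail a)))
      ≡⟨ cong (suc k +_) (vertexLab (tail a)) ⟨
    suc k + lab L (inj₁ (tail a)) ∎
    where
      open ≡-Reasoning
      open Digraph (dipath k (orientation k))
      L : TotalLabeling (suc k) k
      L = zigzagLabeling
      i d : ℕ
      i = toℕ a
      d = k ∸ i
      vertexLab : ∀ v → lab L (inj₁ v) ≡ suc (zigzag k (toℕ v))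
      vertexLab v = lab-zigzagLabeling (inj₁ v)
      weight : ∀ m d h → suc (m + d) + suc h ≡ suc m + suc (h + d)
      weight = solve-∀

mainTheorem1 : (k : ℕ) → Σ (Fin k → Bool) λ o →
    Σ (TotalLabeling (suc k) k) λ L →
      IsStrong L × IsSAML (dipath k o) L (suc k)
mainTheorem1 k =
  orientation k , zigzagLabeling k , zigzagLabeling-strong k , zigzagLabeling-saml k
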